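{- For any $n\ge1$ and $\alpha\in\mathbb{Z}^n$, \[ \mathrm{Tes}_{(1,\alpha)}(q,t)=\mathrm{Tes}_\alpha(q,t)+\sum_{i=1}^n\mathrm{Tes}_{(\alpha_1,\dots,\alpha_{i-1},\alpha_i+1,\alpha_{i+1},\dots,\alpha_n)}(q,t). \]
   Context: Tesler matrices: an $m\times m$ integer matrix $U$ is a Tesler matrix if it is upper triangular, has no zero row, and every row is entirely nonnegative or entirely nonpositive. Hook sums: $\operatorname{hooks}_i(U)=(U_{i,i}+\dots+U_{i,m})-(U_{1,i}+\dots+U_{i-1,i})$; $\mathrm{Tes}(\alpha)$ is the set of $m\times m$ Tesler matrices with $\operatorname{hooks}(U)=\alpha\in\mathbb{Z}^m$. Let $M=(1-q)(1-t)$ and $[k]_{q,t}=(q^k-t^k)/(q-t)$ for $k\in\mathbb{Z}$; $\operatorname{wt}(U;q,t)=(-1)^{\operatorname{entries}^+(U)-\operatorname{rows}^+(U)}M^{\operatorname{nonzero}(U)-m}\prod_{U_{i,j}\neq0}[U_{i,j}]_{q,t}$, where $\operatorname{entries}^+$ counts positive entries, $\operatorname{rows}^+$ counts rows whose nonzero entries are all positive, and $\operatorname{nonzero}$ counts nonzero entries. $\mathrm{Tes}_\alpha(q,t)=\sum_{U\in\mathrm{Tes}(\alpha)}\operatorname{wt}(U;q,t)$. $(1,\alpha)$ denotes $\alpha$ with $1$ prepended. -}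

module Defs where

open import Level using (Level)
open import Data.Nat as ℕ using (ℕ; zero; suc; _∸_)
open import Data.Integer as ℤ using (ℤ; +_; -[1+_]; ∣_∣)
import Data.Integer.Properties as ℤP
open import Data.Fin as Fin using (Fin; zero; suc)
import Data.Fin.Properties as FinP
open import Data.Vec as Vec using (Vec; lookup; tabulate; _∷_; updateAt)
open import Data.List using (List; []; _∷_)
open import Data.List.Membership.Propositional using (_∈_)
open import Data.List.Relation.Unary.Unique.Propositional using (Unique)
open import Data.Bool using (Bool; true; false; if_then_else_; _∧_; _∨_)
open import Data.Product using (_×_; ∃)
open import Data.Sum using (_⊎_)
open import Function.Bundles using (_⇔_)
open import Relation.Nullary using (¬_; does)
open import Relation.Binary.PropositionalEquality using (_≡_)
open import Algebra.Bundles using (CommutativeRing)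

Mat : ℕ → Set
Mat m = Vec (Vec ℤ m) m

entry : ∀ {m} → Mat m → Fin m → Fin m → ℤ
entry U i j = lookup (lookup U i) j

Σℤ : ∀ {m} → (Fin m → ℤ) → ℤ
Σℤ {zero}  f = + 0
Σℤ {suc m} f = f zero ℤ.+ Σℤ (λ i → f (suc i))

count : ∀ {m} → (Fin m → Bool) → ℕ
count {zero}  b = 0
count {suc m} b = (if b zero then 1 else 0) ℕ.+ count (λ i → b (suc i))

allB : ∀ {m} → (Fin m → Bool) → Bool
allB {zero}  b = true
allB {suc m} b = b zero ∧ allB (λ i → b (suc i))

IsTesler : ∀ {m} → Mat m → Set
IsTesler {m} U =
  (∀ (i j : Fin m) → j Fin.< i → entry U i j ≡ + 0)
  × (∀ (i : Fin m) → ∃ λ (j : Fin m) → ¬ (entry U i j ≡ + 0))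
  × (∀ (i : Fin m) → (∀ j → + 0 ℤ.≤ entry U i j) ⊎ (∀ j → entry U i j ℤ.≤ + 0))

hook : ∀ {m} → Mat m → Fin m → ℤ
hook U i =
  Σℤ (λ j → if does (i FinP.≤? j) then entry U i j else + 0)
  ℤ.- Σℤ (λ k → if does (k FinP.<? i) then entry U k i else + 0)

hooks : ∀ {m} → Mat m → Vec ℤ m
hooks U = tabulate (hook U)

InTes : ∀ {m} → Vec ℤ m → Mat m → Set
InTes α U = IsTesler U × hooks U ≡ α

Enumerates : ∀ {m} → Vec ℤ m → List (Mat m) → Set
Enumerates α L = Unique L × (∀ U → (U ∈ L) ⇔ InTes α U)

isZ : ℤ → Bool
isZ a = does (a ℤ.≟ + 0)

isPos : ℤ → Bool
isPos a = does (+ 0 ℤ.<? a)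

Σℕ : ∀ {m} → (Fin m → ℕ) → ℕ
Σℕ {zero}  f = 0
Σℕ {suc m} f = f zero ℕ.+ Σℕ (λ i → f (suc i))

entriesPos : ∀ {m} → Mat m → ℕ
entriesPos U = Σℕ (λ i → count (λ j → isPos (entry U i j)))

rowsPos : ∀ {m} → Mat m → ℕ
rowsPos U = count (λ i → allB (λ j → isZ (entry U i j) ∨ isPos (entry U i j)))

nonzero : ∀ {m} → Mat m → ℕ
nonzero U = Σℕ (λ i → count (λ j → Data.Bool.not (isZ (entry U i j))))
  where import Data.Bool

-- Weights, evaluated in an arbitrary commutative ring R at elements q, t
-- together with chosen elements q⁻¹, t⁻¹ (meant to be inverses of q, t;
-- the inverse hypotheses are imposed in the statement).

module Weights {c ℓ : Level} (R : CommutativeRing c ℓ)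
               (q t q⁻¹ t⁻¹ : CommutativeRing.Carrier R) where
  open CommutativeRing R using (Carrier; _+_; _*_; -_; _-_; 0#; 1#)

  pow : Carrier → ℕ → Carrier
  pow x zero    = 1#
  pow x (suc n) = x * pow x n

  ΣR : ∀ {m} → (Fin m → Carrier) → Carrier
  ΣR {zero}  f = 0#
  ΣR {suc m} f = f zero + ΣR (λ i → f (suc i))

  ΠR : ∀ {m} → (Fin m → Carrier) → Carrier
  ΠR {zero}  f = 1#
  ΠR {suc m} f = f zero * ΠR (λ i → f (suc i))

  -- [n]_{q,t} = (q^n - t^n)/(q - t) = Σ_{j<n} q^j t^{n-1-j}   (n ≥ 0)
  qtNat : ℕ → Carrier
  qtNat n = ΣR {n} (λ j → pow q (Fin.toℕ j) * pow t (n ∸ suc (Fin.toℕ j)))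

  -- [k]_{q,t} for k ∈ ℤ;  for k = -n < 0:
  -- (q^{-n} - t^{-n})/(q - t) = -(q⁻¹ t⁻¹)^n [n]_{q,t}
  qtInt : ℤ → Carrier
  qtInt (+ n)      = qtNat n
  qtInt -[1+ n ]   = - (pow (q⁻¹ * t⁻¹) (suc n) * qtNat (suc n))

  M : Carrier
  M = (1# - q) * (1# - t)

  sgn : ℤ → Carrier
  sgn k = pow (- 1#) ∣ k ∣

  -- wt(U;q,t).  The exponent nonzero(U) - m is a natural number for
  -- Tesler matrices (no zero row), so truncated subtraction is exact there.
  wt : ∀ {m} → Mat m → Carrier
  wt {m} U =
    sgn (+ entriesPos U ℤ.- + rowsPos U)
    * (pow M (nonzero U ∸ m)
    * ΠR (λ i → ΠR (λ j → if isZ (entry U i j) then 1# else qtInt (entry U i j))))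

  wtSum : ∀ {m} → List (Mat m) → Carrier
  wtSum []       = 0#
  wtSum (U ∷ L)  = wt U + wtSum L

-- A Tesler matrix with hooks (1, α) has as first row a nonnegative row of sum 1,
-- i.e. a unit vector, and (by upper triangularity) a zero first column. Deleting
-- this row and column is a bijection onto the Tesler matrices whose hooks are α
-- when the 1 sits on the diagonal, and α with α_i raised by one when it sits in
-- column i + 1. The deleted row contributes one positive entry, one positive row,
-- one nonzero entry, one extra dimension and a factor [1]_{q,t} = 1, so weights
-- are preserved, and summing over the position of the 1 gives the recursion.
module Submission where

open import Defs
open import Level using (Level)
open import Data.Bool using (Bool; true; false; if_then_else_; _∨_; not)
open import Data.Nat as ℕ using (ℕ; zero; suc; _∸_; _≤_; z≤n; s≤s; s≤s⁻¹)
open import Data.Integer as ℤ using (ℤ; +_; +≤+; _+_; _-_; -_)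
import Data.Integer.Properties as ℤP
open import Data.Fin as Fin using (Fin; zero; suc)
import Data.Fin.Properties as FinP
open import Data.Vec as Vec using (Vec; []; _∷_; lookup; tabulate; replicate; updateAt)
import Data.Vec.Properties as VecP
import Data.Vec.Relation.Binary.Pointwise.Extensional as Pointwise
open import Data.List using (List; []; _∷_; _++_; map; concat)
import Data.List as List
open import Data.List.Membership.Propositional using (_∈_)
open import Data.List.Membership.Propositional.Properties
  using (∈-map⁺; ∈-map⁻; ∈-concat⁺′; ∈-concat⁻′; ∈-tabulate⁺; ∈-tabulate⁻)
open import Data.List.Membership.Setoid.Properties using (unique⇒irrelevant)
open import Data.List.Relation.Unary.Unique.Propositional using (Unique)
import Data.List.Relation.Unary.Unique.Propositional.Properties as Unique
import Data.List.Relation.Unary.All.Properties as All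
import Data.List.Relation.Unary.AllPairs.Properties as AllPairs
open import Data.List.Relation.Binary.Disjoint.Propositional using (Disjoint)
open import Data.List.Relation.Binary.Permutation.Propositional as ↭ using (_↭_)
open import Data.List.Relation.Binary.BagAndSetEquality using (∼bag⇒↭)
open import Data.Product using (_×_; _,_; proj₁; proj₂; ∃; ∃₂)
open import Data.Sum using (_⊎_; inj₁; inj₂)
open import Data.Empty using (⊥-elim)
open import Function using (_∘_)
open import Function.Bundles using (_⇔_; mk⇔; mk↔ₛ′; Equivalence)
import Function.Properties.Equivalence as ⇔
open import Relation.Nullary using (¬_; does)
open import Relation.Nullary.Decidable using (does-⇔)
open import Relation.Binary.Definitions using (DecidableEquality)
open import Relation.Binary.PropositionalEquality
  using (_≡_; _≢_; refl; sym; trans; cong; cong₂; subst; setoid; module ≡-Reasoning)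
open import Axiom.UniquenessOfIdentityProofs using (module Decidable⇒UIP)
open import Algebra.Bundles using (CommutativeRing; AbelianGroup)
open import Algebra.Properties.Group (AbelianGroup.group ℤP.+-0-abelianGroup)
  using (//-rightDividesˡ; //-rightDividesʳ)

module _ {a} {A : Set a} where

  -- Duplicate-free lists have proof-irrelevant membership (A has decidable,
  -- hence UIP, equality), so equal membership makes them bag equal.
  unique-⇔⇒↭ : DecidableEquality A → {xs ys : List A} → Unique xs → Unique ys →
    (∀ x → x ∈ xs ⇔ x ∈ ys) → xs ↭ ys
  unique-⇔⇒↭ _≟_ uxs uys xs⇔ys = ∼bag⇒↭ λ {x} →
    mk↔ₛ′ (Equivalence.to (xs⇔ys x)) (Equivalence.from (xs⇔ys x))
      (λ _ → irrelevant uys _ _) (λ _ → irrelevant uxs _ _)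
    where
    irrelevant : ∀ {zs} → Unique zs → ∀ {x} (p q : x ∈ zs) → p ≡ q
    irrelevant = unique⇒irrelevant (setoid A) (Decidable⇒UIP.≡-irrelevant _≟_)

  module _ {n} (F : Fin n → List A) where

    ∈-concat∘tabulate⁺ : ∀ {x} i → x ∈ F i → x ∈ concat (List.tabulate F)
    ∈-concat∘tabulate⁺ i x∈Fi = ∈-concat⁺′ x∈Fi (∈-tabulate⁺ i)

    ∈-concat∘tabulate⁻ : ∀ {x} → x ∈ concat (List.tabulate F) → ∃ λ i → x ∈ F i
    ∈-concat∘tabulate⁻ x∈ with _ , x∈xs , xs∈ ← ∈-concat⁻′ (List.tabulate F) x∈
                         with i , refl ← ∈-tabulate⁻ xs∈ = i , x∈xs

    concat∘tabulate⁺ : (∀ i → Unique (F i)) → (∀ {i j} → i ≢ j → Disjoint (F i) (F j)) →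
      Unique (concat (List.tabulate F))
    concat∘tabulate⁺ u disj = Unique.concat⁺ (All.tabulate⁺ u) (AllPairs.tabulate⁺ disj)

tabulate≡⇔ : ∀ {a} {A : Set a} {n} (f : Fin n → A) {v : Vec A n} →
  tabulate f ≡ v ⇔ (∀ i → f i ≡ lookup v i)
tabulate≡⇔ f = mk⇔
  (λ { refl i → sym (VecP.lookup∘tabulate f i) })
  (λ f≗v → Pointwise.Pointwise-≡⇒≡ (Pointwise.ext λ i →
     trans (VecP.lookup∘tabulate f i) (f≗v i)))

-≡⇔≡+ : ∀ x d a → x - d ≡ a ⇔ x ≡ a + d
-≡⇔≡+ x d a = mk⇔
  (λ { refl → sym (//-rightDividesˡ d x) })
  (λ { refl → //-rightDividesʳ d a })

unitRow : ∀ {m} → Fin m → Vec ℤ m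
unitRow zero    = + 1 ∷ replicate _ (+ 0)
unitRow (suc j) = + 0 ∷ unitRow j

adjoin : ∀ {n} → Fin (suc n) → Mat n → Mat (suc n)
adjoin j V = unitRow j ∷ Vec.map (+ 0 ∷_) V

-- raise α j is α plus the last n entries of unitRow j.
raise : ∀ {n} → Vec ℤ n → Fin (suc n) → Vec ℤ n
raise α zero    = α
raise α (suc i) = updateAt α i (λ a → a + + 1)

unitRow-injective : ∀ {m} {i j : Fin m} → unitRow i ≡ unitRow j → i ≡ j
unitRow-injective {i = zero}  {zero}  _ = refl
unitRow-injective {i = suc i} {suc j} p = cong suc (unitRow-injective (VecP.∷-injectiveʳ p))

map-cons-injective : ∀ {m n} {x : ℤ} {U V : Vec (Vec ℤ n) m} →
  Vec.map (x ∷_) U ≡ Vec.map (x ∷_) V → U ≡ V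
map-cons-injective {U = []}    {[]}    _ = refl
map-cons-injective {U = _ ∷ _} {_ ∷ _} p with p₀ , ps ← VecP.∷-injective p =
  cong₂ _∷_ (VecP.∷-injectiveʳ p₀) (map-cons-injective ps)

adjoin-injective : ∀ {n} {i j : Fin (suc n)} {U V : Mat n} →
  adjoin i U ≡ adjoin j V → i ≡ j × U ≡ V
adjoin-injective p with p₀ , ps ← VecP.∷-injective p =
  unitRow-injective p₀ , map-cons-injective ps

lookup-adjoin : ∀ {n} j (V : Mat n) i → lookup (adjoin j V) (suc i) ≡ + 0 ∷ lookup V i
lookup-adjoin j V i = VecP.lookup-map i (+ 0 ∷_) V

lookup-unitRow-nonneg : ∀ {m} (j k : Fin m) → + 0 ℤ.≤ lookup (unitRow j) k
lookup-unitRow-nonneg zero    zero    = +≤+ z≤n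
lookup-unitRow-nonneg zero    (suc k) = subst (+ 0 ℤ.≤_) (sym (VecP.lookup-replicate k (+ 0))) (+≤+ z≤n)
lookup-unitRow-nonneg (suc j) zero    = +≤+ z≤n
lookup-unitRow-nonneg (suc j) (suc k) = lookup-unitRow-nonneg j k

lookup-raise : ∀ {n} (α : Vec ℤ n) j i → lookup (raise α j) i ≡ lookup α i + lookup (unitRow j) (suc i)
lookup-raise α zero i = begin
  lookup α i                                 ≡⟨ ℤP.+-identityʳ _ ⟨
  lookup α i + + 0                           ≡⟨ cong (λ x → lookup α i + x) (VecP.lookup-replicate i (+ 0)) ⟨
  lookup α i + lookup (replicate _ (+ 0)) i  ∎
  where open ≡-Reasoning
lookup-raise (a ∷ α) (suc zero)    zero    = refl
lookup-raise (a ∷ α) (suc (suc j)) zero    = sym (ℤP.+-identityʳ a)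
lookup-raise (a ∷ α) (suc zero)    (suc i) = lookup-raise α zero i
lookup-raise (a ∷ α) (suc (suc j)) (suc i) = lookup-raise α (suc j) i

isTesler-adjoin⁺ : ∀ {n} j (V : Mat n) → IsTesler V → IsTesler (adjoin j V)
isTesler-adjoin⁺ {n} j V (upper , nonzeroRow , signed) = upper′ , nonzeroRow′ , signed′
  where
  upper′ : ∀ (i k : Fin (suc n)) → k Fin.< i → entry (adjoin j V) i k ≡ + 0
  upper′ (suc i) zero    _       rewrite lookup-adjoin j V i = refl
  upper′ (suc i) (suc k) (s≤s p) rewrite lookup-adjoin j V i = upper i k p

  nonzeroRow′ : ∀ (i : Fin (suc n)) → ∃ λ k → ¬ (entry (adjoin j V) i k ≡ + 0)
  nonzeroRow′ zero = j , unitRow-self j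
    where
    unitRow-self : ∀ {m} (j : Fin m) → ¬ (lookup (unitRow j) j ≡ + 0)
    unitRow-self zero    ()
    unitRow-self (suc j) = unitRow-self j
  nonzeroRow′ (suc i) rewrite lookup-adjoin j V i with k , k≢0 ← nonzeroRow i = suc k , k≢0

  signed′ : ∀ (i : Fin (suc n)) →
    (∀ k → + 0 ℤ.≤ entry (adjoin j V) i k) ⊎ (∀ k → entry (adjoin j V) i k ℤ.≤ + 0)
  signed′ zero = inj₁ (lookup-unitRow-nonneg j)
  signed′ (suc i) rewrite lookup-adjoin j V i with signed i
  ... | inj₁ nonneg = inj₁ λ { zero → +≤+ z≤n ; (suc k) → nonneg k }
  ... | inj₂ nonpos = inj₂ λ { zero → +≤+ z≤n ; (suc k) → nonpos k }

isTesler-adjoin⁻ : ∀ {n} j (V : Mat n) → IsTesler (adjoin j V) → IsTesler V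
isTesler-adjoin⁻ {n} j V (upper , nonzeroRow , signed) = upper′ , nonzeroRow′ , signed′
  where
  upper′ : ∀ (i k : Fin n) → k Fin.< i → entry V i k ≡ + 0
  upper′ i k p with upper (suc i) (suc k) (s≤s p)
  ... | r rewrite lookup-adjoin j V i = r

  nonzeroRow′ : ∀ (i : Fin n) → ∃ λ k → ¬ (entry V i k ≡ + 0)
  nonzeroRow′ i with nonzeroRow (suc i)
  ... | k , k≢0 rewrite lookup-adjoin j V i with k
  ...   | zero  = ⊥-elim (k≢0 refl)
  ...   | suc k = k , k≢0

  signed′ : ∀ (i : Fin n) → (∀ k → + 0 ℤ.≤ entry V i k) ⊎ (∀ k → entry V i k ℤ.≤ + 0)
  signed′ i with signed (suc i)
  ... | inj₁ nonneg rewrite lookup-adjoin j V i = inj₁ (nonneg ∘ suc)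
  ... | inj₂ nonpos rewrite lookup-adjoin j V i = inj₂ (nonpos ∘ suc)

Σℤ-cong : ∀ {m} {f g : Fin m → ℤ} → (∀ k → f k ≡ g k) → Σℤ f ≡ Σℤ g
Σℤ-cong {zero}  _   = refl
Σℤ-cong {suc m} f≗g = cong₂ _+_ (f≗g zero) (Σℤ-cong (f≗g ∘ suc))

Σℤ-zero : ∀ {m} → Σℤ {m} (λ _ → + 0) ≡ + 0
Σℤ-zero {zero}  = refl
Σℤ-zero {suc m} = trans (ℤP.+-identityˡ _) (Σℤ-zero {m})

Σℤ-replicate-zero : ∀ {m} → Σℤ (lookup (replicate m (+ 0))) ≡ + 0
Σℤ-replicate-zero {m} = trans
  (Σℤ-cong {m} (λ k → VecP.lookup-replicate k (+ 0))) (Σℤ-zero {m})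

Σℤ-unitRow : ∀ {m} (j : Fin m) → Σℤ (lookup (unitRow j)) ≡ + 1
Σℤ-unitRow (zero {m}) = cong (_+_ (+ 1)) (Σℤ-replicate-zero {m})
Σℤ-unitRow (suc j)    = cong (_+_ (+ 0)) (Σℤ-unitRow j)

hook-adjoin-zero : ∀ {n} j (V : Mat n) → hook (adjoin j V) zero ≡ + 1
hook-adjoin-zero {n} j V = cong₂ _-_ (Σℤ-unitRow j) (Σℤ-zero {suc n})

hook-adjoin-suc : ∀ {n} j (V : Mat n) i →
  hook (adjoin j V) (suc i) ≡ hook V i - lookup (unitRow j) (suc i)
hook-adjoin-suc {n} j V i = begin
  hook (adjoin j V) (suc i)  ≡⟨ cong₂ (λ r c → (+ 0 + r) - (e + c)) (Σℤ-cong row) (Σℤ-cong column) ⟩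
  (+ 0 + r) - (e + c)        ≡⟨ cong (ℤ._- (e + c)) (ℤP.+-identityˡ r) ⟩
  r - (e + c)                ≡⟨ cong (_+_ r) (ℤP.neg-distrib-+ e c) ⟩
  r + (- e + - c)            ≡⟨ cong (_+_ r) (ℤP.+-comm (- e) (- c)) ⟩
  r + (- c + - e)            ≡⟨ ℤP.+-assoc r (- c) (- e) ⟨
  (r - c) - e                ∎
  where
  open ≡-Reasoning
  e r c : ℤ
  e = lookup (unitRow j) (suc i)
  r = Σℤ (λ k → if does (i FinP.≤? k) then entry V i k else + 0)
  c = Σℤ (λ k → if does (k FinP.<? i) then entry V k i else + 0)

  row : ∀ k → (if does (suc i FinP.≤? suc k) then entry (adjoin j V) (suc i) (suc k) else + 0)
            ≡ (if does (i FinP.≤? k) then entry V i k else + 0)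
  row k rewrite does-⇔ (mk⇔ s≤s⁻¹ s≤s) (suc i FinP.≤? suc k) (i FinP.≤? k)
              | lookup-adjoin j V i = refl

  column : ∀ k → (if does (suc k FinP.<? suc i) then entry (adjoin j V) (suc k) (suc i) else + 0)
               ≡ (if does (k FinP.<? i) then entry V k i else + 0)
  column k rewrite lookup-adjoin j V k = refl

hooks-adjoin⇔ : ∀ {n} (α : Vec ℤ n) j (V : Mat n) →
  hooks (adjoin j V) ≡ + 1 ∷ α ⇔ hooks V ≡ raise α j
hooks-adjoin⇔ {n} α j V = mk⇔ to from
  where
  d : Fin n → ℤ
  d i = lookup (unitRow j) (suc i)

  to : hooks (adjoin j V) ≡ + 1 ∷ α → hooks V ≡ raise α j
  to h = Equivalence.from (tabulate≡⇔ (hook V)) λ i → trans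
    (Equivalence.to (-≡⇔≡+ (hook V i) (d i) (lookup α i))
      (trans (sym (hook-adjoin-suc j V i)) (Equivalence.to (tabulate≡⇔ (hook (adjoin j V))) h (suc i))))
    (sym (lookup-raise α j i))

  from : hooks V ≡ raise α j → hooks (adjoin j V) ≡ + 1 ∷ α
  from h = Equivalence.from (tabulate≡⇔ (hook (adjoin j V))) λ
    { zero    → hook-adjoin-zero j V
    ; (suc i) → trans (hook-adjoin-suc j V i)
        (Equivalence.from (-≡⇔≡+ (hook V i) (d i) (lookup α i))
          (trans (Equivalence.to (tabulate≡⇔ (hook V)) h i) (lookup-raise α j i))) }

Σℤ-nonneg : ∀ {m} (r : Vec ℤ m) → (∀ k → + 0 ℤ.≤ lookup r k) → + 0 ℤ.≤ Σℤ (lookup r)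
Σℤ-nonneg []      _      = +≤+ z≤n
Σℤ-nonneg (x ∷ r) nonneg = ℤP.+-mono-≤ (nonneg zero) (Σℤ-nonneg r (nonneg ∘ suc))

Σℤ-nonpos : ∀ {m} (r : Vec ℤ m) → (∀ k → lookup r k ℤ.≤ + 0) → Σℤ (lookup r) ℤ.≤ + 0
Σℤ-nonpos []      _      = +≤+ z≤n
Σℤ-nonpos (x ∷ r) nonpos = ℤP.+-mono-≤ (nonpos zero) (Σℤ-nonpos r (nonpos ∘ suc))

nonneg-+≡0 : ∀ {x y} → + 0 ℤ.≤ x → + 0 ℤ.≤ y → x + y ≡ + 0 → x ≡ + 0 × y ≡ + 0
nonneg-+≡0 {+ 0}     {+ 0}     _ _ _  = refl , refl
nonneg-+≡0 {+ 0}     {+ suc _} _ _ ()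
nonneg-+≡0 {+ suc _} {+ _}     _ _ ()

nonneg-+≡1 : ∀ {x y} → + 0 ℤ.≤ x → + 0 ℤ.≤ y → x + y ≡ + 1 →
  (x ≡ + 0 × y ≡ + 1) ⊎ (x ≡ + 1 × y ≡ + 0)
nonneg-+≡1 {+ 0}           {+ _}     _ _ x+y≡1 = inj₁ (refl , x+y≡1)
nonneg-+≡1 {+ 1}           {+ 0}     _ _ _     = inj₂ (refl , refl)
nonneg-+≡1 {+ 1}           {+ suc _} _ _ ()
nonneg-+≡1 {+ suc (suc _)} {+ _}     _ _ ()

nonneg-Σℤ≡0⇒replicate : ∀ {m} (r : Vec ℤ m) → (∀ k → + 0 ℤ.≤ lookup r k) →
  Σℤ (lookup r) ≡ + 0 → r ≡ replicate m (+ 0)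
nonneg-Σℤ≡0⇒replicate []      _      _ = refl
nonneg-Σℤ≡0⇒replicate (x ∷ r) nonneg Σ≡0
  with refl , Σr≡0 ← nonneg-+≡0 (nonneg zero) (Σℤ-nonneg r (nonneg ∘ suc)) Σ≡0 =
  cong (+ 0 ∷_) (nonneg-Σℤ≡0⇒replicate r (nonneg ∘ suc) Σr≡0)

nonneg-Σℤ≡1⇒unitRow : ∀ {m} (r : Vec ℤ m) → (∀ k → + 0 ℤ.≤ lookup r k) →
  Σℤ (lookup r) ≡ + 1 → ∃ λ j → r ≡ unitRow j
nonneg-Σℤ≡1⇒unitRow (x ∷ r) nonneg Σ≡1
  with nonneg-+≡1 (nonneg zero) (Σℤ-nonneg r (nonneg ∘ suc)) Σ≡1
... | inj₁ (refl , Σr≡1) with j , refl ← nonneg-Σℤ≡1⇒unitRow r (nonneg ∘ suc) Σr≡1 = suc j , refl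
... | inj₂ (refl , Σr≡0) = zero , cong (+ 1 ∷_) (nonneg-Σℤ≡0⇒replicate r (nonneg ∘ suc) Σr≡0)

zeroColumn⇒map-cons : ∀ {m n} (rs : Vec (Vec ℤ (suc n)) m) →
  (∀ i → lookup (lookup rs i) zero ≡ + 0) → rs ≡ Vec.map (+ 0 ∷_) (Vec.map Vec.tail rs)
zeroColumn⇒map-cons []             _        = refl
zeroColumn⇒map-cons ((x ∷ r) ∷ rs) column≡0 =
  cong₂ _∷_ (cong (_∷ r) (column≡0 zero)) (zeroColumn⇒map-cons rs (column≡0 ∘ suc))

hook-zero : ∀ {n} (U : Mat (suc n)) → hook U zero ≡ Σℤ (lookup (lookup U zero))
hook-zero {n} (r ∷ _) = trans (cong (_-_ (Σℤ (lookup r))) (Σℤ-zero {suc n})) (ℤP.+-identityʳ _)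

adjoin-surjective : ∀ {n} (U : Mat (suc n)) → IsTesler U → hook U zero ≡ + 1 →
  ∃₂ λ j V → U ≡ adjoin j V
adjoin-surjective U@(r ∷ rs) (upper , _ , signed) hook≡1 with signed zero
... | inj₁ nonneg with j , refl ← nonneg-Σℤ≡1⇒unitRow r nonneg (trans (sym (hook-zero U)) hook≡1) =
  j , Vec.map Vec.tail rs , cong (unitRow j ∷_) (zeroColumn⇒map-cons rs λ i → upper (suc i) zero (s≤s z≤n))
... | inj₂ nonpos with +≤+ () ← subst (ℤ._≤ + 0) (trans (sym (hook-zero U)) hook≡1) (Σℤ-nonpos r nonpos)

enumerates-↭ : ∀ {m} {α : Vec ℤ m} {L L′ : List (Mat m)} → Enumerates α L → Enumerates α L′ → L ↭ L′
enumerates-↭ (uL , memL) (uL′ , memL′) =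
  unique-⇔⇒↭ (VecP.≡-dec (VecP.≡-dec ℤ._≟_)) uL uL′ λ U → ⇔.trans (memL U) (⇔.sym (memL′ U))

module _ {n} (T : Fin (suc n) → List (Mat n)) where

  adjoined : Fin (suc n) → List (Mat (suc n))
  adjoined j = map (adjoin j) (T j)

  adjoinAll : List (Mat (suc n))
  adjoinAll = concat (List.tabulate adjoined)

  enumerates-adjoinAll : (α : Vec ℤ n) → (∀ j → Enumerates (raise α j) (T j)) →
    Enumerates (+ 1 ∷ α) adjoinAll
  enumerates-adjoinAll α enumT = unique , λ U → mk⇔ sound (complete U)
    where
    disjoint : ∀ {i j} → i ≢ j → Disjoint (adjoined i) (adjoined j)
    disjoint i≢j (U∈i , U∈j) with _ , _ , refl ← ∈-map⁻ (adjoin _) U∈i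
                             with _ , _ , eq ← ∈-map⁻ (adjoin _) U∈j = i≢j (proj₁ (adjoin-injective eq))

    unique : Unique adjoinAll
    unique = concat∘tabulate⁺ adjoined (λ j → Unique.map⁺ (proj₂ ∘ adjoin-injective) (proj₁ (enumT j))) disjoint

    sound : ∀ {U} → U ∈ adjoinAll → InTes (+ 1 ∷ α) U
    sound U∈ with j , U∈j ← ∈-concat∘tabulate⁻ adjoined U∈
             with V , V∈ , refl ← ∈-map⁻ (adjoin j) U∈j
             with tesler , hooks≡ ← Equivalence.to (proj₂ (enumT j) V) V∈ =
      isTesler-adjoin⁺ j V tesler , Equivalence.from (hooks-adjoin⇔ α j V) hooks≡

    complete : ∀ U → InTes (+ 1 ∷ α) U → U ∈ adjoinAll
    complete U (tesler , hooks≡) with j , V , refl ← adjoin-surjective U tesler (cong Vec.head hooks≡) =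
      ∈-concat∘tabulate⁺ adjoined j (∈-map⁺ (adjoin j) (Equivalence.from (proj₂ (enumT j) V)
        (isTesler-adjoin⁻ j V tesler , Equivalence.to (hooks-adjoin⇔ α j V) hooks≡)))

countEntries : ∀ {m} → (ℤ → Bool) → Mat m → ℕ
countEntries g U = Σℕ (λ i → count (λ k → g (entry U i k)))

Σℕ-cong : ∀ {m} {f g : Fin m → ℕ} → (∀ k → f k ≡ g k) → Σℕ f ≡ Σℕ g
Σℕ-cong {zero}  _   = refl
Σℕ-cong {suc m} f≗g = cong₂ ℕ._+_ (f≗g zero) (Σℕ-cong (f≗g ∘ suc))

count-cong : ∀ {m} {f g : Fin m → Bool} → (∀ k → f k ≡ g k) → count f ≡ count g
count-cong {zero}  _   = refl
count-cong {suc m} f≗g =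
  cong₂ ℕ._+_ (cong (λ b → if b then 1 else 0) (f≗g zero)) (count-cong (f≗g ∘ suc))

module _ (g : ℤ → Bool) (g0 : g (+ 0) ≡ false) where

  count-replicate-zero : ∀ {m} → count (λ k → g (lookup (replicate m (+ 0)) k)) ≡ 0
  count-replicate-zero {zero}  = refl
  count-replicate-zero {suc m} rewrite g0 = count-replicate-zero {m}

  module _ (g1 : g (+ 1) ≡ true) where

    count-unitRow : ∀ {m} (j : Fin m) → count (λ k → g (lookup (unitRow j) k)) ≡ 1
    count-unitRow (zero {m}) rewrite g1 = cong suc (count-replicate-zero {m})
    count-unitRow (suc j)    rewrite g0 = count-unitRow j

    countEntries-adjoin : ∀ {n} j (V : Mat n) → countEntries g (adjoin j V) ≡ suc (countEntries g V)
    countEntries-adjoin j V = cong₂ ℕ._+_ (count-unitRow j) (Σℕ-cong row)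
      where
      row : ∀ i → count (λ k → g (entry (adjoin j V) (suc i) k)) ≡ count (λ k → g (entry V i k))
      row i rewrite lookup-adjoin j V i | g0 = refl

module _ (g : ℤ → Bool) (g0 : g (+ 0) ≡ true) where

  allB-replicate-zero : ∀ {m} → allB (λ k → g (lookup (replicate m (+ 0)) k)) ≡ true
  allB-replicate-zero {zero}  = refl
  allB-replicate-zero {suc m} rewrite g0 = allB-replicate-zero {m}

  allB-unitRow : g (+ 1) ≡ true → ∀ {m} (j : Fin m) → allB (λ k → g (lookup (unitRow j) k)) ≡ true
  allB-unitRow g1 (zero {m}) rewrite g1 = allB-replicate-zero {m}
  allB-unitRow g1 (suc j)    rewrite g0 = allB-unitRow g1 j

rowsPos-adjoin : ∀ {n} j (V : Mat n) → rowsPos (adjoin j V) ≡ suc (rowsPos V)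
rowsPos-adjoin j V rewrite allB-unitRow (λ a → isZ a ∨ isPos a) refl refl j = cong suc (count-cong row)
  where
  row : ∀ i → allB (λ k → isZ (entry (adjoin j V) (suc i) k) ∨ isPos (entry (adjoin j V) (suc i) k))
            ≡ allB (λ k → isZ (entry V i k) ∨ isPos (entry V i k))
  row i rewrite lookup-adjoin j V i = refl

+[1+m]-+[1+n]≡+m-+n : ∀ a b → + suc a - + suc b ≡ + a - + b
+[1+m]-+[1+n]≡+m-+n a b = trans (ℤP.[1+m]⊖[1+n]≡m⊖n a b) (sym (ℤP.m-n≡m⊖n a b))

module WeightProperties {c ℓ} (R : CommutativeRing c ℓ) (q t q⁻¹ t⁻¹ : CommutativeRing.Carrier R) where

  open CommutativeRing R
    using (Carrier; _≈_; _*_; 1#; reflexive; +-cong; +-congˡ; +-assoc; +-comm;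
           +-identityˡ; +-identityʳ; *-cong; *-identityˡ)
    renaming (_+_ to _⊕_; refl to ≈-refl; sym to ≈-sym; trans to ≈-trans)
  open Weights R q t q⁻¹ t⁻¹
  open import Relation.Binary.Reasoning.Setoid (CommutativeRing.setoid R)

  ΣR-cong : ∀ {m} {f g : Fin m → Carrier} → (∀ i → f i ≈ g i) → ΣR f ≈ ΣR g
  ΣR-cong {zero}  _   = ≈-refl
  ΣR-cong {suc m} f≈g = +-cong (f≈g zero) (ΣR-cong (f≈g ∘ suc))

  ΠR-cong : ∀ {m} {f g : Fin m → Carrier} → (∀ i → f i ≈ g i) → ΠR f ≈ ΠR g
  ΠR-cong {zero}  _   = ≈-refl
  ΠR-cong {suc m} f≈g = *-cong (f≈g zero) (ΠR-cong (f≈g ∘ suc))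

  wtSum-++ : ∀ {m} (L L′ : List (Mat m)) → wtSum (L ++ L′) ≈ wtSum L ⊕ wtSum L′
  wtSum-++ []      L′ = ≈-sym (+-identityˡ _)
  wtSum-++ (U ∷ L) L′ = begin
    wt U ⊕ wtSum (L ++ L′)        ≈⟨ +-congˡ (wtSum-++ L L′) ⟩
    wt U ⊕ (wtSum L ⊕ wtSum L′)   ≈⟨ +-assoc _ _ _ ⟨
    (wt U ⊕ wtSum L) ⊕ wtSum L′   ∎

  wtSum-↭ : ∀ {m} {L L′ : List (Mat m)} → L ↭ L′ → wtSum L ≈ wtSum L′
  wtSum-↭ ↭.refl          = ≈-refl
  wtSum-↭ (↭.prep U p)    = +-congˡ (wtSum-↭ p)
  wtSum-↭ (↭.swap U V p)  = begin
    wt U ⊕ (wt V ⊕ _)   ≈⟨ +-assoc _ _ _ ⟨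
    (wt U ⊕ wt V) ⊕ _   ≈⟨ +-cong (+-comm _ _) (wtSum-↭ p) ⟩
    (wt V ⊕ wt U) ⊕ _   ≈⟨ +-assoc _ _ _ ⟩
    wt V ⊕ (wt U ⊕ _)   ∎
  wtSum-↭ (↭.trans p p′)  = ≈-trans (wtSum-↭ p) (wtSum-↭ p′)

  wtSum-concat∘tabulate : ∀ {m k} (F : Fin k → List (Mat m)) →
    wtSum (concat (List.tabulate F)) ≈ ΣR (wtSum ∘ F)
  wtSum-concat∘tabulate {k = zero}  F = ≈-refl
  wtSum-concat∘tabulate {k = suc k} F = begin
    wtSum (F zero ++ concat (List.tabulate (F ∘ suc)))         ≈⟨ wtSum-++ (F zero) _ ⟩
    wtSum (F zero) ⊕ wtSum (concat (List.tabulate (F ∘ suc)))  ≈⟨ +-congˡ (wtSum-concat∘tabulate (F ∘ suc)) ⟩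
    wtSum (F zero) ⊕ ΣR (wtSum ∘ F ∘ suc)                      ∎

  wtSum-map : ∀ {m n} (f : Mat m → Mat n) → (∀ U → wt (f U) ≈ wt U) → ∀ L → wtSum (map f L) ≈ wtSum L
  wtSum-map f wt∘f≈wt []      = ≈-refl
  wtSum-map f wt∘f≈wt (U ∷ L) = +-cong (wt∘f≈wt U) (wtSum-map f wt∘f≈wt L)

  factor : ℤ → Carrier
  factor a = if isZ a then 1# else qtInt a

  ΠR-replicate-zero : ∀ {m} → ΠR (λ k → factor (lookup (replicate m (+ 0)) k)) ≈ 1#
  ΠR-replicate-zero {zero}  = ≈-refl
  ΠR-replicate-zero {suc m} = ≈-trans (*-identityˡ _) (ΠR-replicate-zero {m})

  qtInt-one : qtInt (+ 1) ≈ 1#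
  qtInt-one = ≈-trans (+-identityʳ _) (*-identityˡ _)

  ΠR-unitRow : ∀ {m} (j : Fin m) → ΠR (λ k → factor (lookup (unitRow j) k)) ≈ 1#
  ΠR-unitRow (zero {m}) = ≈-trans (*-cong qtInt-one (ΠR-replicate-zero {m})) (*-identityˡ _)
  ΠR-unitRow (suc j)    = ≈-trans (*-identityˡ _) (ΠR-unitRow j)

  ΠR-adjoin : ∀ {n} j (V : Mat n) →
    ΠR (λ i → ΠR (λ k → factor (entry (adjoin j V) i k))) ≈ ΠR (λ i → ΠR (λ k → factor (entry V i k)))
  ΠR-adjoin j V = ≈-trans (*-cong (ΠR-unitRow j) (ΠR-cong row)) (*-identityˡ _)
    where
    row : ∀ i → ΠR (λ k → factor (entry (adjoin j V) (suc i) k)) ≈ ΠR (λ k → factor (entry V i k))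
    row i rewrite lookup-adjoin j V i = *-identityˡ _

  wt-adjoin : ∀ {n} j (V : Mat n) → wt (adjoin j V) ≈ wt V
  wt-adjoin {n} j V = *-cong (reflexive sign≡) (*-cong (reflexive power≡) (ΠR-adjoin j V))
    where
    sign≡ : sgn (+ entriesPos (adjoin j V) - + rowsPos (adjoin j V)) ≡ sgn (+ entriesPos V - + rowsPos V)
    sign≡ rewrite countEntries-adjoin isPos refl refl j V | rowsPos-adjoin j V =
      cong sgn (+[1+m]-+[1+n]≡+m-+n (entriesPos V) (rowsPos V))

    power≡ : pow M (nonzero (adjoin j V) ∸ suc n) ≡ pow M (nonzero V ∸ n)
    power≡ rewrite countEntries-adjoin (not ∘ isZ) refl refl j V = refl

lemma4p5 : ∀ {c ℓ : Level} (R : CommutativeRing c ℓ)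
    (q t q⁻¹ t⁻¹ : CommutativeRing.Carrier R) →
    CommutativeRing._≈_ R (CommutativeRing._*_ R q q⁻¹) (CommutativeRing.1# R) →
    CommutativeRing._≈_ R (CommutativeRing._*_ R t t⁻¹) (CommutativeRing.1# R) →
    (n : ℕ) → 1 ≤ n → (α : Vec ℤ n) →
    (L₀ : List (Mat (suc n))) → Enumerates (+ 1 ∷ α) L₀ →
    (L : List (Mat n)) → Enumerates α L →
    (Ls : Fin n → List (Mat n)) →
    ((i : Fin n) → Enumerates (updateAt α i (λ a → a ℤ.+ + 1)) (Ls i)) →
    CommutativeRing._≈_ R
      (Weights.wtSum R q t q⁻¹ t⁻¹ L₀)
      (CommutativeRing._+_ R (Weights.wtSum R q t q⁻¹ t⁻¹ L)
        (Weights.ΣR R q t q⁻¹ t⁻¹ (λ i → Weights.wtSum R q t q⁻¹ t⁻¹ (Ls i))))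
lemma4p5 R q t q⁻¹ t⁻¹ _ _ n _ α L₀ enumL₀ L enumL Ls enumLs = begin
  wtSum L₀                       ≈⟨ wtSum-↭ (enumerates-↭ enumL₀ (enumerates-adjoinAll T α enumT)) ⟩
  wtSum (adjoinAll T)            ≈⟨ wtSum-concat∘tabulate (adjoined T) ⟩
  ΣR (wtSum ∘ adjoined T)        ≈⟨ ΣR-cong (λ j → wtSum-map (adjoin j) (wt-adjoin j) (T j)) ⟩
  ΣR (wtSum ∘ T)                 ∎
  where
  open Weights R q t q⁻¹ t⁻¹
  open WeightProperties R q t q⁻¹ t⁻¹
  open import Relation.Binary.Reasoning.Setoid (CommutativeRing.setoid R)

  -- ΣR (wtSum ∘ T) unfolds to the right-hand side wtSum L + ΣR (wtSum ∘ Ls).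
  T : Fin (suc n) → List (Mat n)
  T zero    = L
  T (suc i) = Ls i

  enumT : ∀ j → Enumerates (raise α j) (T j)
  enumT zero    = enumL
  enumT (suc i) = enumLs i
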